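{- Let $G_1=(V,E_1)$ and $G_2=(V,E_2)$ be graphs, $n:=|V|$. Define $G'=(V',E')$ by $V'=\{v_1,v_2\mid v\in V\}$ and $E'=\{\{v_1,v_2\}\mid v\in V\}\cup\{\{u_i,v_i\}\mid i\in\{1,2\},\ \{u,v\}\in E_i\}$, and define $w\colon E'\to\mathbb{N}$ by $w(\{v_1,v_2\})=n$ for $v\in V$ and $w(\{u_i,v_i\})=n+1$ for $u\neq v$. Let $k\in\mathbb{N}$. Then there is a set $X\subseteq V$ with $|X|\ge k$ such that both $G_1[X]$ and $G_2[X]$ have a perfect matching if and only if $G'$ has a matching of total $w$-weight at least $n^2+k$. -}

module Defs where

open import Data.Nat using (ℕ; suc; _+_; _*_; _≤_)
open import Data.Fin using (Fin; zero; suc; _≟_)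
open import Data.Fin.Subset using (Subset; _∈_; ∣_∣)
open import Data.Product using (_×_; _,_; ∃-syntax; Σ-syntax)
open import Data.Sum using (_⊎_)
open import Data.Bool using (if_then_else_)
open import Data.List using (List; []; _∷_; concatMap; map)
open import Data.Nat.ListAction using (sum)
open import Data.List.Relation.Unary.All using (All)
open import Data.List.Relation.Unary.Unique.Propositional using (Unique)
import Data.List.Membership.Propositional as L
open import Relation.Binary.PropositionalEquality using (_≡_; _≢_)
open import Relation.Nullary using (¬_)
open import Relation.Nullary.Decidable using (⌊_⌋)

record Graph (n : ℕ) : Set₁ where
  field
    Adj     : Fin n → Fin n → Set
    symmetric   : ∀ {u v} → Adj u v → Adj v u
    irreflexive : ∀ {u} → ¬ Adj u u
open Graph public

-- Edges are represented as ordered pairs (u , v) standing for {u, v}.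
-- The list of vertices covered by a list of edges.
endpoints : {A : Set} → List (A × A) → List A
endpoints = concatMap (λ { (u , v) → u ∷ v ∷ [] })

IsMatching : {A : Set} → (A → A → Set) → List (A × A) → Set
IsMatching Adj M = All (λ { (u , v) → Adj u v }) M × Unique (endpoints M)

IsPerfectMatchingOf : ∀ {n} → Graph n → Subset n → List (Fin n × Fin n) → Set
IsPerfectMatchingOf G X M =
  IsMatching (Adj G) M
  × All (λ { (u , v) → u ∈ X × v ∈ X }) M
  × (∀ x → x ∈ X → x L.∈ endpoints M)

HasPerfectMatching : ∀ {n} → Graph n → Subset n → Set
HasPerfectMatching G X = ∃[ M ] IsPerfectMatchingOf G X M

-- The graph G' on V' = V × {1,2}; the vertex (v , i) is v_{i+1}.
pick : ∀ {n} → Graph n → Graph n → Fin 2 → Graph n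
pick G₁ G₂ zero    = G₁
pick G₁ G₂ (suc _) = G₂

AdjG' : ∀ {n} → Graph n → Graph n → Fin n × Fin 2 → Fin n × Fin 2 → Set
AdjG' G₁ G₂ (u , i) (v , j) =
  (u ≡ v × i ≢ j)
  ⊎ (i ≡ j × Adj (pick G₁ G₂ i) u v)

w : (n : ℕ) → Fin n × Fin 2 → Fin n × Fin 2 → ℕ
w n (u , _) (v , _) = if ⌊ u ≟ v ⌋ then n else suc n

weight : (n : ℕ) → List ((Fin n × Fin 2) × (Fin n × Fin 2)) → ℕ
weight n M = sum (map (λ { (a , b) → w n a b }) M)

-- Every edge of G′ weighs n plus an excess that is 1 on the layer edges {u_i, v_i} and 0 on
-- the rungs {v₁, v₂}, so a matching M weighs n·|M| + excess M with excess M ≤ |M| ≤ n.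
-- Perfect matchings M₁ of G₁[X] and M₂ of G₂[X], placed in their layers and completed by the
-- rungs at the vertices outside X, form a perfect matching of G′ of weight n² + |X|.
-- Conversely, weight ≥ n² + k forces |M| = n, i.e. M covers all of V′. If v₁ is matched inside
-- layer 1, then v₂ is not matched by the rung {v₁, v₂}, so it is matched inside layer 2, and
-- vice versa. Hence both layers of M are perfect matchings of the same set X, and
-- k ≤ excess M ≤ |M₁| + |M₂| = |X|.

module Submission where

open import Defs
open import Data.Nat using (ℕ; zero; suc; _+_; _*_; _∸_; _≤_; _<_; z≤n; s≤s)
open import Data.Nat.Properties hiding (_≟_)
open import Data.Fin using (Fin; zero; suc; _≟_)
import Data.Fin.Properties as Fin
open import Data.Fin.Subset as Subset using (Subset; ∣_∣; ∁; inside; outside)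
  renaming (_∈_ to _∈ₛ_; _∉_ to _∉ₛ_)
open import Data.Fin.Subset.Properties using (∣p∣≤n; ∣∁p∣≡n∸∣p∣; x∈∁p⇒x∉p)
open import Data.Product using (_×_; _,_; proj₁; proj₂; ∃-syntax)
import Data.Product as Product
open import Data.Product.Properties using (≡-dec)
open import Data.Sum using (_⊎_; inj₁; inj₂)
import Data.Sum as Sum
open import Data.Bool using (if_then_else_)
open import Data.List using (List; []; _∷_; _++_; map; length; allFin)
open import Data.List.Properties using (length-map; length-++; length-++-sucʳ; length-tabulate)
open import Data.List.Relation.Unary.All as All using (All; []; _∷_)
open import Data.List.Relation.Unary.All.Properties using (¬Any⇒All¬) renaming (++⁺ to All-++⁺)
open import Data.List.Relation.Unary.Any using (here; there)
open import Data.List.Relation.Unary.AllPairs using ([]; _∷_)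
open import Data.List.Relation.Unary.Unique.Propositional using (Unique)
import Data.List.Relation.Unary.Unique.Propositional.Properties as Unique
open import Data.List.Membership.Propositional using (_∈_; _∉_)
import Data.List.Membership.DecPropositional as DecMembership
open import Data.List.Membership.Propositional.Properties
  using (∈-∃++; ∈-++⁻; ∈-++⁺ˡ; ∈-++⁺ʳ; ∈-map⁺; ∈-map⁻; ∈-allFin)
open import Data.List.Relation.Binary.Subset.Propositional using (_⊆_)
open import Data.List.Relation.Binary.Disjoint.Propositional using (Disjoint)
open import Data.Vec using (tabulate; []; _∷_)
import Data.Vec.Base as Vec
open import Data.Vec.Properties using (lookup∘tabulate; []=⇒lookup; lookup⇒[]=)
open import Relation.Binary.PropositionalEquality
open import Relation.Binary.Definitions using (DecidableEquality)
open import Relation.Nullary using (¬_; yes; no; does; contradiction)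
open import Relation.Nullary.Decidable using (⌊_⌋; _×-dec_; dec-true)
open import Data.Empty using (⊥-elim)
open import Data.Nat.Tactic.RingSolver using (solve-∀)
open import Function.Base using (_∘_; id)
open import Function.Bundles using (_⇔_; mk⇔)

private
  variable
    n : ℕ

module _ {a} {A : Set a} where

  Unique-⊆⇒length≤ : ∀ {xs ys : List A} → Unique xs → xs ⊆ ys → length xs ≤ length ys
  Unique-⊆⇒length≤ {[]} _ _ = z≤n
  Unique-⊆⇒length≤ {x ∷ xs} (x∉xs ∷ xs!) x∷xs⊆ys with ∈-∃++ (x∷xs⊆ys (here refl))
  ... | ys₁ , ys₂ , refl = begin
    suc (length xs)            ≤⟨ s≤s (Unique-⊆⇒length≤ xs! xs⊆ys₁++ys₂) ⟩
    suc (length (ys₁ ++ ys₂))  ≡⟨ length-++-sucʳ ys₁ x ys₂ ⟨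
    length (ys₁ ++ x ∷ ys₂)    ∎
    where
    open ≤-Reasoning
    xs⊆ys₁++ys₂ : xs ⊆ ys₁ ++ ys₂
    xs⊆ys₁++ys₂ y∈xs with ∈-++⁻ ys₁ (x∷xs⊆ys (there y∈xs))
    ... | inj₁ y∈ys₁         = ∈-++⁺ˡ y∈ys₁
    ... | inj₂ (here refl)   = contradiction refl (All.lookup x∉xs y∈xs)
    ... | inj₂ (there y∈ys₂) = ∈-++⁺ʳ ys₁ y∈ys₂

  Unique-⊆-length≥⇒⊇ : DecidableEquality A → ∀ {xs ys : List A} →
                        Unique xs → xs ⊆ ys → length ys ≤ length xs → ys ⊆ xs
  Unique-⊆-length≥⇒⊇ _≟ᴬ_ {xs} {ys} xs! xs⊆ys ys≤xs {y} y∈ys with DecMembership._∈?_ _≟ᴬ_ y xs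
  ... | yes y∈xs = y∈xs
  ... | no  y∉xs = contradiction ys≤xs (<⇒≱ (Unique-⊆⇒length≤ (¬Any⇒All¬ xs y∉xs ∷ xs!) y∷xs⊆ys))
    where
    y∷xs⊆ys : y ∷ xs ⊆ ys
    y∷xs⊆ys (here refl) = y∈ys
    y∷xs⊆ys (there z∈xs) = xs⊆ys z∈xs

elements : Subset n → List (Fin n)
elements []            = []
elements (inside  ∷ p) = zero ∷ map suc (elements p)
elements (outside ∷ p) = map suc (elements p)

length-elements : (p : Subset n) → length (elements p) ≡ ∣ p ∣
length-elements []            = refl
length-elements (inside  ∷ p) = cong suc (trans (length-map suc (elements p)) (length-elements p))
length-elements (outside ∷ p) = trans (length-map suc (elements p)) (length-elements p)

∈-elements⁺ : ∀ {p : Subset n} {x} → x ∈ₛ p → x ∈ elements p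
∈-elements⁺ {p = inside  ∷ p} Vec.here      = here refl
∈-elements⁺ {p = inside  ∷ p} (Vec.there x∈p) = there (∈-map⁺ suc (∈-elements⁺ x∈p))
∈-elements⁺ {p = outside ∷ p} (Vec.there x∈p) = ∈-map⁺ suc (∈-elements⁺ x∈p)

∈-elements⁻ : ∀ {p : Subset n} {x} → x ∈ elements p → x ∈ₛ p
∈-elements⁻ {p = inside  ∷ p} (here refl) = Vec.here
∈-elements⁻ {p = inside  ∷ p} (there x∈p) with ∈-map⁻ suc x∈p
... | _ , y∈p , refl = Vec.there (∈-elements⁻ y∈p)
∈-elements⁻ {p = outside ∷ p} x∈p with ∈-map⁻ suc x∈p
... | _ , y∈p , refl = Vec.there (∈-elements⁻ y∈p)

elements-Unique : (p : Subset n) → Unique (elements p)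
elements-Unique []            = []
elements-Unique (inside  ∷ p) =
  ¬Any⇒All¬ _ zero∉suc ∷ Unique.map⁺ Fin.suc-injective (elements-Unique p)
  where
  zero∉suc : ∀ {xs} → ¬ (zero ∈ map suc xs)
  zero∉suc zero∈ with ∈-map⁻ suc zero∈
  ... | _ , _ , ()
elements-Unique (outside ∷ p) = Unique.map⁺ Fin.suc-injective (elements-Unique p)

Unique-⊆ₛ⇒length≤∣∣ : ∀ {xs} {p : Subset n} → Unique xs → (∀ {x} → x ∈ xs → x ∈ₛ p) → length xs ≤ ∣ p ∣
Unique-⊆ₛ⇒length≤∣∣ {p = p} xs! xs⊆p =
  subst (_ ≤_) (length-elements p) (Unique-⊆⇒length≤ xs! (∈-elements⁺ ∘ xs⊆p))

⊆ₛ⇒∣∣≤length : ∀ {xs} {p : Subset n} → (∀ {x} → x ∈ₛ p → x ∈ xs) → ∣ p ∣ ≤ length xs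
⊆ₛ⇒∣∣≤length {p = p} p⊆xs =
  subst (_≤ _) (length-elements p) (Unique-⊆⇒length≤ (elements-Unique p) (p⊆xs ∘ ∈-elements⁻))

∈-tabulate⁺ : ∀ {f : Fin n → Subset.Side} {x} → f x ≡ inside → x ∈ₛ tabulate f
∈-tabulate⁺ {f = f} {x} fx≡inside = lookup⇒[]= x (tabulate f) (trans (lookup∘tabulate f x) fx≡inside)

∈-tabulate⁻ : ∀ {f : Fin n → Subset.Side} {x} → x ∈ₛ tabulate f → f x ≡ inside
∈-tabulate⁻ {f = f} {x} x∈f = trans (sym (lookup∘tabulate f x)) ([]=⇒lookup x∈f)

module _ {n : ℕ} where

  open DecMembership (_≟_ {n}) using (_∈?_)

  fromList : List (Fin n) → Subset n
  fromList xs = tabulate (λ x → does (x ∈? xs))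

  ∈-fromList⁺ : ∀ {xs : List (Fin n)} {x} → x ∈ xs → x ∈ₛ fromList xs
  ∈-fromList⁺ {xs = xs} {x} x∈xs = ∈-tabulate⁺ (dec-true (x ∈? xs) x∈xs)

  ∈-fromList⁻ : ∀ {xs : List (Fin n)} {x} → x ∈ₛ fromList xs → x ∈ xs
  ∈-fromList⁻ {xs = xs} {x} x∈X with x ∈? xs | ∈-tabulate⁻ {f = λ x → does (x ∈? xs)} x∈X
  ... | yes x∈xs | _ = x∈xs

module _ {A : Set} where

  infix 4 _∈ᵉ_
  _∈ᵉ_ : A → A × A → Set
  x ∈ᵉ (u , v) = x ≡ u ⊎ x ≡ v

  ∈-endpoints⁻ : ∀ {x} (M : List (A × A)) → x ∈ endpoints M → ∃[ e ] (e ∈ M × x ∈ᵉ e)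
  ∈-endpoints⁻ ((u , v) ∷ M) (here x≡u)         = (u , v) , here refl , inj₁ x≡u
  ∈-endpoints⁻ ((u , v) ∷ M) (there (here x≡v)) = (u , v) , here refl , inj₂ x≡v
  ∈-endpoints⁻ ((u , v) ∷ M) (there (there x∈M)) with ∈-endpoints⁻ M x∈M
  ... | e , e∈M , x∈e = e , there e∈M , x∈e

  ∈-endpoints⁺ : ∀ {x e} {M : List (A × A)} → e ∈ M → x ∈ᵉ e → x ∈ endpoints M
  ∈-endpoints⁺ (here refl) (inj₁ x≡u) = here x≡u
  ∈-endpoints⁺ (here refl) (inj₂ x≡v) = there (here x≡v)
  ∈-endpoints⁺ {M = _ ∷ _} (there e∈M) x∈e = there (there (∈-endpoints⁺ e∈M x∈e))

  length-endpoints : (M : List (A × A)) → length (endpoints M) ≡ length M + length M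
  length-endpoints []      = refl
  length-endpoints (_ ∷ M) =
    cong suc (trans (cong suc (length-endpoints M)) (sym (+-suc (length M) (length M))))

  endpoints-++ : (M N : List (A × A)) → endpoints (M ++ N) ≡ endpoints M ++ endpoints N
  endpoints-++ []            N = refl
  endpoints-++ ((u , v) ∷ M) N = cong (λ vs → u ∷ v ∷ vs) (endpoints-++ M N)

  endpoints-map : ∀ {B : Set} (f : B → A) (M : List (B × B)) →
                  endpoints (map (Product.map f f) M) ≡ map f (endpoints M)
  endpoints-map f []            = refl
  endpoints-map f ((u , v) ∷ M) = cong (λ vs → f u ∷ f v ∷ vs) (endpoints-map f M)

  end-not-repeated : ∀ {u v x} {vs : List A} →
                     All (u ≢_) (v ∷ vs) → All (v ≢_) vs → x ∈ᵉ (u , v) → x ∉ vs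
  end-not-repeated u∉ _  (inj₁ refl) x∈vs = All.lookup u∉ (there x∈vs) refl
  end-not-repeated _  v∉ (inj₂ refl) x∈vs = All.lookup v∉ x∈vs refl

  matching-edge-unique : ∀ {x e₁ e₂} {M : List (A × A)} → Unique (endpoints M) →
                         e₁ ∈ M → e₂ ∈ M → x ∈ᵉ e₁ → x ∈ᵉ e₂ → e₁ ≡ e₂
  matching-edge-unique _ (here refl) (here refl) _ _ = refl
  matching-edge-unique (u∉ ∷ v∉ ∷ _) (here refl) (there e₂∈M) x∈e₁ x∈e₂ =
    ⊥-elim (end-not-repeated u∉ v∉ x∈e₁ (∈-endpoints⁺ e₂∈M x∈e₂))
  matching-edge-unique (u∉ ∷ v∉ ∷ _) (there e₁∈M) (here refl) x∈e₁ x∈e₂ =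
    ⊥-elim (end-not-repeated u∉ v∉ x∈e₂ (∈-endpoints⁺ e₁∈M x∈e₁))
  matching-edge-unique {M = _ ∷ _} (_ ∷ _ ∷ M!) (there e₁∈M) (there e₂∈M) x∈e₁ x∈e₂ =
    matching-edge-unique M! e₁∈M e₂∈M x∈e₁ x∈e₂

half-≤ : ∀ {m n} → m + m ≤ n + n → m ≤ n
half-≤ m+m≤n+n = ≮⇒≥ (λ n<m → <⇒≱ (+-mono-< n<m n<m) m+m≤n+n)

double-injective : ∀ {m n} → m + m ≡ n + n → m ≡ n
double-injective eq = ≤-antisym (half-≤ (≤-reflexive eq)) (half-≤ (≤-reflexive (sym eq)))

module _ {G : Graph n} {X : Subset n} {M : List (Fin n × Fin n)} where

  perfectMatching-endpoints⊆ : IsPerfectMatchingOf G X M → ∀ {x} → x ∈ endpoints M → x ∈ₛ X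
  perfectMatching-endpoints⊆ (_ , M⊆X , _) x∈M with ∈-endpoints⁻ M x∈M
  ... | e , e∈M , inj₁ refl = proj₁ (All.lookup M⊆X e∈M)
  ... | e , e∈M , inj₂ refl = proj₂ (All.lookup M⊆X e∈M)

  length-perfectMatching : IsPerfectMatchingOf G X M → length M + length M ≡ ∣ X ∣
  length-perfectMatching pm@((_ , M!) , _ , covers) = ≤-antisym
    (subst (_≤ ∣ X ∣) (length-endpoints M) (Unique-⊆ₛ⇒length≤∣∣ M! (perfectMatching-endpoints⊆ pm)))
    (subst (∣ X ∣ ≤_) (length-endpoints M) (⊆ₛ⇒∣∣≤length (covers _)))

length-perfectMatchings : ∀ {G₁ G₂ : Graph n} {X M₁ M₂} →
                          IsPerfectMatchingOf G₁ X M₁ → IsPerfectMatchingOf G₂ X M₂ →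
                          length M₁ + length M₂ ≡ ∣ X ∣
length-perfectMatchings {G₁ = G₁} {G₂} {X} {M₁} {M₂} pm₁ pm₂ =
  trans (cong (length M₁ +_) (sym l₁≡l₂)) (length-perfectMatching {G = G₁} pm₁)
  where
  l₁≡l₂ : length M₁ ≡ length M₂
  l₁≡l₂ = double-injective
    (trans (length-perfectMatching {G = G₁} pm₁) (sym (length-perfectMatching {G = G₂} pm₂)))

Vertex′ : ℕ → Set
Vertex′ n = Fin n × Fin 2

Edge′ : ℕ → Set
Edge′ n = Vertex′ n × Vertex′ n

copy : Fin 2 → Fin n → Vertex′ n
copy i x = x , i

excessᵉ : Edge′ n → ℕ
excessᵉ ((u , _) , (v , _)) = if ⌊ u ≟ v ⌋ then 0 else 1

excess : List (Edge′ n) → ℕ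
excess []      = 0
excess (e ∷ M) = excessᵉ e + excess M

excessᵉ-rung : ∀ (u : Fin n) a b → excessᵉ ((u , a) , (u , b)) ≡ 0
excessᵉ-rung u _ _ with u ≟ u
... | yes _   = refl
... | no  u≢u = contradiction refl u≢u

excessᵉ-≢ : ∀ {u v : Fin n} a b → u ≢ v → excessᵉ ((u , a) , (v , b)) ≡ 1
excessᵉ-≢ {u = u} {v} _ _ u≢v with u ≟ v
... | yes u≡v = contradiction u≡v u≢v
... | no  _   = refl

excessᵉ≤1 : (e : Edge′ n) → excessᵉ e ≤ 1
excessᵉ≤1 ((u , _) , (v , _)) with u ≟ v
... | yes _ = z≤n
... | no  _ = s≤s z≤n

excess≤length : (M : List (Edge′ n)) → excess M ≤ length M
excess≤length []      = z≤n
excess≤length (e ∷ M) = +-mono-≤ (excessᵉ≤1 e) (excess≤length M)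

excess-++ : (M N : List (Edge′ n)) → excess (M ++ N) ≡ excess M + excess N
excess-++ []      N = refl
excess-++ (e ∷ M) N =
  trans (cong (excessᵉ e +_) (excess-++ M N)) (sym (+-assoc (excessᵉ e) (excess M) (excess N)))

w≡n+excessᵉ : (a b : Vertex′ n) → w n a b ≡ n + excessᵉ (a , b)
w≡n+excessᵉ {n} (u , _) (v , _) with u ≟ v
... | yes _ = sym (+-identityʳ n)
... | no  _ = +-comm 1 n

weight≡ : (M : List (Edge′ n)) → weight n M ≡ n * length M + excess M
weight≡ {n} []      = sym (trans (+-identityʳ (n * 0)) (*-zeroʳ n))
weight≡ {n} ((a , b) ∷ M) = begin
  w n a b + weight n M                          ≡⟨ cong₂ _+_ (w≡n+excessᵉ a b) (weight≡ M) ⟩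
  n + excessᵉ (a , b) + (n * length M + excess M) ≡⟨ regroup n (excessᵉ (a , b)) (length M) (excess M) ⟩
  n * suc (length M) + (excessᵉ (a , b) + excess M) ∎
  where
  open ≡-Reasoning
  regroup : ∀ n e l x → n + e + (n * l + x) ≡ n * suc l + (e + x)
  regroup = solve-∀

length<⇒weight< : ∀ {M : List (Edge′ n)} → length M < n → weight n M < n * n
length<⇒weight< {n} {M} |M|<n = begin-strict
  weight n M               ≡⟨ weight≡ M ⟩
  n * length M + excess M  ≤⟨ +-monoʳ-≤ (n * length M) (excess≤length M) ⟩
  n * length M + length M  <⟨ +-monoʳ-< (n * length M) |M|<n ⟩
  n * length M + n         ≡⟨ +-comm (n * length M) n ⟩
  n + n * length M         ≡⟨ *-suc n (length M) ⟨
  n * suc (length M)       ≤⟨ *-monoʳ-≤ n |M|<n ⟩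
  n * n                    ∎
  where open ≤-Reasoning

layer : Fin 2 → List (Edge′ n) → List (Fin n × Fin n)
layer i [] = []
layer i (((u , a) , (v , b)) ∷ M) with a ≟ i ×-dec b ≟ i
... | yes _ = (u , v) ∷ layer i M
... | no  _ = layer i M

module _ (i : Fin 2) where

  ∈-layer⁺ : ∀ {M : List (Edge′ n)} {u v} → ((u , i) , (v , i)) ∈ M → (u , v) ∈ layer i M
  ∈-layer⁺ {M = ((_ , a) , (_ , b)) ∷ M} e∈M with a ≟ i ×-dec b ≟ i | e∈M
  ... | yes (refl , refl) | here refl = here refl
  ... | yes _             | there e∈M = there (∈-layer⁺ e∈M)
  ... | no  ¬i,i          | here refl = contradiction (refl , refl) ¬i,i
  ... | no  _             | there e∈M = ∈-layer⁺ e∈M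

  ∈-layer⁻ : ∀ {M : List (Edge′ n)} {u v} → (u , v) ∈ layer i M → ((u , i) , (v , i)) ∈ M
  ∈-layer⁻ {M = ((_ , a) , (_ , b)) ∷ M} e∈Mᵢ with a ≟ i ×-dec b ≟ i | e∈Mᵢ
  ... | yes (refl , refl) | here refl = here refl
  ... | yes _             | there e∈Mᵢ = there (∈-layer⁻ {M = M} e∈Mᵢ)
  ... | no  _             | e∈Mᵢ       = there (∈-layer⁻ {M = M} e∈Mᵢ)

  ∈-endpoints-layer⁻ : ∀ {M : List (Edge′ n)} {x} → x ∈ endpoints (layer i M) → (x , i) ∈ endpoints M
  ∈-endpoints-layer⁻ {M = M} x∈Mᵢ with ∈-endpoints⁻ (layer i M) x∈Mᵢ
  ... | _ , e∈Mᵢ , inj₁ refl = ∈-endpoints⁺ (∈-layer⁻ {M = M} e∈Mᵢ) (inj₁ refl)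
  ... | _ , e∈Mᵢ , inj₂ refl = ∈-endpoints⁺ (∈-layer⁻ {M = M} e∈Mᵢ) (inj₂ refl)

  layer-Unique : (M : List (Edge′ n)) → Unique (endpoints M) → Unique (endpoints (layer i M))
  layer-Unique [] _ = []
  layer-Unique (((u , a) , (v , b)) ∷ M) (u∉ ∷ v∉ ∷ M!) with a ≟ i ×-dec b ≟ i
  ... | yes (refl , refl) = ¬Any⇒All¬ _ u∉Mᵢ ∷ ¬Any⇒All¬ _ v∉Mᵢ ∷ layer-Unique M M!
    where
    u∉Mᵢ : ¬ (u ∈ v ∷ endpoints (layer i M))
    u∉Mᵢ (here refl)  = All.lookup u∉ (here refl) refl
    u∉Mᵢ (there u∈Mᵢ) = All.lookup u∉ (there (∈-endpoints-layer⁻ {M = M} u∈Mᵢ)) refl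
    v∉Mᵢ : ¬ (v ∈ endpoints (layer i M))
    v∉Mᵢ v∈Mᵢ = All.lookup v∉ (∈-endpoints-layer⁻ {M = M} v∈Mᵢ) refl
  ... | no  _ = layer-Unique M M!

∈ᵉ-rung : ∀ {u : Fin n} {a b : Fin 2} → a ≢ b → ∀ c → (u , c) ∈ᵉ ((u , a) , (u , b))
∈ᵉ-rung {a = zero}     {zero}     0≢0 _          = contradiction refl 0≢0
∈ᵉ-rung {a = zero}     {suc zero} _   zero       = inj₁ refl
∈ᵉ-rung {a = zero}     {suc zero} _   (suc zero) = inj₂ refl
∈ᵉ-rung {a = suc zero} {zero}     _   zero       = inj₂ refl
∈ᵉ-rung {a = suc zero} {zero}     _   (suc zero) = inj₁ refl
∈ᵉ-rung {a = suc zero} {suc zero} 1≢1 _          = contradiction refl 1≢1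

layer-end-not-on-rung : ∀ {M : List (Edge′ n)} {i x a b} → Unique (endpoints M) →
                        x ∈ endpoints (layer i M) → a ≢ b → ((x , a) , (x , b)) ∉ M
layer-end-not-on-rung {M = M} {i} M! x∈Mᵢ a≢b rung∈M with ∈-endpoints⁻ (layer i M) x∈Mᵢ
... | _ , e∈Mᵢ , x∈e
    with matching-edge-unique M! rung∈M (∈-layer⁻ i {M = M} e∈Mᵢ)
           (∈ᵉ-rung a≢b i) (Sum.map (cong (copy i)) (cong (copy i)) x∈e)
... | refl = a≢b refl

embed : Fin 2 → List (Fin n × Fin n) → List (Edge′ n)
embed i = map (Product.map (copy i) (copy i))

rungs : List (Fin n) → List (Edge′ n)
rungs = map (λ v → (v , zero) , (v , suc zero))

excess-embed : ∀ (G : Graph n) i (M : List (Fin n × Fin n)) → All (λ { (u , v) → Adj G u v }) M →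
               excess (embed i M) ≡ length M
excess-embed G i []            []          = refl
excess-embed G i ((u , v) ∷ M) (uv ∷ adjs) =
  cong₂ _+_ (excessᵉ-≢ i i (λ { refl → irreflexive G uv })) (excess-embed G i M adjs)

excess-rungs : (vs : List (Fin n)) → excess (rungs vs) ≡ 0
excess-rungs []       = refl
excess-rungs (v ∷ vs) = cong₂ _+_ (excessᵉ-rung v zero (suc zero)) (excess-rungs vs)

∈-endpoints-rungs⁺ : ∀ {vs : List (Fin n)} {x} j → x ∈ vs → (x , j) ∈ endpoints (rungs vs)
∈-endpoints-rungs⁺ zero       (here refl) = here refl
∈-endpoints-rungs⁺ (suc zero) (here refl) = there (here refl)
∈-endpoints-rungs⁺ j          (there x∈vs) = there (there (∈-endpoints-rungs⁺ j x∈vs))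

∈-endpoints-rungs⁻ : ∀ {vs : List (Fin n)} {a} → a ∈ endpoints (rungs vs) → proj₁ a ∈ vs
∈-endpoints-rungs⁻ {vs = v ∷ vs} (here refl)         = here refl
∈-endpoints-rungs⁻ {vs = v ∷ vs} (there (here refl)) = here refl
∈-endpoints-rungs⁻ {vs = v ∷ vs} (there (there a∈))  = there (∈-endpoints-rungs⁻ a∈)

rungs-Unique : (vs : List (Fin n)) → Unique vs → Unique (endpoints (rungs vs))
rungs-Unique []       _           = []
rungs-Unique (v ∷ vs) (v∉vs ∷ vs!) = ¬Any⇒All¬ _ v₀∉ ∷ ¬Any⇒All¬ _ v₁∉ ∷ rungs-Unique vs vs!
  where
  v₀∉ : ¬ ((v , zero) ∈ (v , suc zero) ∷ endpoints (rungs vs))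
  v₀∉ (there v₀∈) = All.lookup v∉vs (∈-endpoints-rungs⁻ v₀∈) refl
  v₁∉ : ¬ ((v , suc zero) ∈ endpoints (rungs vs))
  v₁∉ v₁∈ = All.lookup v∉vs (∈-endpoints-rungs⁻ v₁∈) refl

vertices′ : (n : ℕ) → List (Vertex′ n)
vertices′ n = endpoints (rungs (allFin n))

∈-vertices′ : (a : Vertex′ n) → a ∈ vertices′ n
∈-vertices′ (x , j) = ∈-endpoints-rungs⁺ j (∈-allFin x)

length-vertices′ : (n : ℕ) → length (vertices′ n) ≡ n + n
length-vertices′ n = begin
  length (endpoints (rungs (allFin n)))   ≡⟨ length-endpoints (rungs (allFin n)) ⟩
  length (rungs (allFin n)) + length (rungs (allFin n))
    ≡⟨ cong (λ l → l + l) (trans (length-map _ (allFin n)) (length-tabulate {n = n} id)) ⟩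
  n + n                                   ∎
  where open ≡-Reasoning

module _ {n} (G₁ G₂ : Graph n) where

  Adj′ : Vertex′ n → Vertex′ n → Set
  Adj′ = AdjG' G₁ G₂

  length-matching≤n : ∀ {M} → IsMatching Adj′ M → length M ≤ n
  length-matching≤n {M} (_ , M!) = half-≤ (begin
    length M + length M      ≡⟨ length-endpoints M ⟨
    length (endpoints M)     ≤⟨ Unique-⊆⇒length≤ M! (λ {a} _ → ∈-vertices′ a) ⟩
    length (vertices′ n)     ≡⟨ length-vertices′ n ⟩
    n + n                    ∎)
    where open ≤-Reasoning

  length-matching≡n⇒covers : ∀ {M} → IsMatching Adj′ M → length M ≡ n → ∀ a → a ∈ endpoints M
  length-matching≡n⇒covers {M} (_ , M!) |M|≡n a =
    Unique-⊆-length≥⇒⊇ (≡-dec _≟_ _≟_) M! (λ {a} _ → ∈-vertices′ a) n+n≤ (∈-vertices′ a)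
    where
    n+n≤ : length (vertices′ n) ≤ length (endpoints M)
    n+n≤ = ≤-reflexive (begin
      length (vertices′ n)  ≡⟨ length-vertices′ n ⟩
      n + n                 ≡⟨ cong (λ l → l + l) |M|≡n ⟨
      length M + length M   ≡⟨ length-endpoints M ⟨
      length (endpoints M)  ∎)
      where open ≡-Reasoning

  embed-adjacent : ∀ i (M : List (Fin n × Fin n)) → All (λ { (u , v) → Adj (pick G₁ G₂ i) u v }) M →
                   All (λ { (a , b) → Adj′ a b }) (embed i M)
  embed-adjacent i []      []          = []
  embed-adjacent i (_ ∷ M) (uv ∷ adjs) = inj₂ (refl , uv) ∷ embed-adjacent i M adjs

  rungs-adjacent : (vs : List (Fin n)) → All (λ { (a , b) → Adj′ a b }) (rungs vs)
  rungs-adjacent []       = []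
  rungs-adjacent (_ ∷ vs) = inj₁ (refl , λ ()) ∷ rungs-adjacent vs

  layer-isMatching : ∀ i {M} → IsMatching Adj′ M → IsMatching (Adj (pick G₁ G₂ i)) (layer i M)
  layer-isMatching i {M} (adjs , M!) =
    All.tabulate (λ e∈Mᵢ → layer-adjacent (All.lookup adjs (∈-layer⁻ i {M = M} e∈Mᵢ))) ,
    layer-Unique i M M!
    where
    layer-adjacent : ∀ {u v} → Adj′ (u , i) (v , i) → Adj (pick G₁ G₂ i) u v
    layer-adjacent (inj₁ (_ , i≢i)) = contradiction refl i≢i
    layer-adjacent (inj₂ (_ , uv))  = uv

  covered-in-every-layer : ∀ {M i j x} → IsMatching Adj′ M →
                           x ∈ endpoints (layer i M) → (x , j) ∈ endpoints M → x ∈ endpoints (layer j M)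
  covered-in-every-layer {M} {i} {j} (adjs , M!) x∈Mᵢ xⱼ∈M with ∈-endpoints⁻ M xⱼ∈M
  ... | _ , e∈M , xⱼ∈e with All.lookup adjs e∈M | xⱼ∈e
  ... | inj₂ (refl , _)   | inj₁ refl = ∈-endpoints⁺ (∈-layer⁺ j e∈M) (inj₁ refl)
  ... | inj₂ (refl , _)   | inj₂ refl = ∈-endpoints⁺ (∈-layer⁺ j e∈M) (inj₂ refl)
  ... | inj₁ (refl , a≢b) | inj₁ refl = contradiction e∈M (layer-end-not-on-rung M! x∈Mᵢ a≢b)
  ... | inj₁ (refl , a≢b) | inj₂ refl = contradiction e∈M (layer-end-not-on-rung M! x∈Mᵢ a≢b)

  excess≤length-layers : ∀ {M} → All (λ { (a , b) → Adj′ a b }) M →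
                         excess M ≤ length (layer zero M) + length (layer (suc zero) M)
  excess≤length-layers {[]} [] = z≤n
  excess≤length-layers {((_ , zero) , (_ , zero)) ∷ _} (inj₁ (_ , 0≢0) ∷ _) =
    contradiction refl 0≢0
  excess≤length-layers {((u , zero) , (_ , suc zero)) ∷ _} (inj₁ (refl , _) ∷ adjs)
    rewrite excessᵉ-rung u zero (suc zero) = excess≤length-layers adjs
  excess≤length-layers {((u , suc zero) , (_ , zero)) ∷ _} (inj₁ (refl , _) ∷ adjs)
    rewrite excessᵉ-rung u (suc zero) zero = excess≤length-layers adjs
  excess≤length-layers {((_ , suc zero) , (_ , suc zero)) ∷ _} (inj₁ (_ , 1≢1) ∷ _) =
    contradiction refl 1≢1
  excess≤length-layers {(e@((_ , zero) , (_ , zero))) ∷ _} (inj₂ _ ∷ adjs) =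
    +-mono-≤ (excessᵉ≤1 e) (excess≤length-layers adjs)
  excess≤length-layers {(e@((_ , suc zero) , (_ , suc zero))) ∷ M} (inj₂ _ ∷ adjs) =
    ≤-trans (+-mono-≤ (excessᵉ≤1 e) (excess≤length-layers adjs))
            (≤-reflexive (sym (+-suc (length (layer zero M)) (length (layer (suc zero) M)))))
  excess≤length-layers {((_ , zero) , (_ , suc zero)) ∷ _} (inj₂ (() , _) ∷ _)
  excess≤length-layers {((_ , suc zero) , (_ , zero)) ∷ _} (inj₂ (() , _) ∷ _)

  layer-isPerfectMatching : ∀ {M} → IsMatching Adj′ M → (∀ a → a ∈ endpoints M) → ∀ i →
                            IsPerfectMatchingOf (pick G₁ G₂ i) (fromList (endpoints (layer zero M))) (layer i M)
  layer-isPerfectMatching {M} m covers i =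
    layer-isMatching i m ,
    All.tabulate (λ e∈Mᵢ → inX (∈-endpoints⁺ e∈Mᵢ (inj₁ refl)) , inX (∈-endpoints⁺ e∈Mᵢ (inj₂ refl))) ,
    λ x x∈X → covered-in-every-layer m (∈-fromList⁻ x∈X) (covers (x , i))
    where
    inX : ∀ {x} → x ∈ endpoints (layer i M) → x ∈ₛ fromList (endpoints (layer zero M))
    inX {x} x∈Mᵢ = ∈-fromList⁺ (covered-in-every-layer m x∈Mᵢ (covers (x , zero)))

  heavy-matching⇒perfectMatchings : ∀ {k} →
    ∃[ M ] (IsMatching Adj′ M × n * n + k ≤ weight n M) →
    ∃[ X ] (k ≤ ∣ X ∣ × HasPerfectMatching G₁ X × HasPerfectMatching G₂ X)
  heavy-matching⇒perfectMatchings {k} (M , m@(adjs , _) , heavy) =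
    X , k≤∣X∣ , (layer zero M , pm₁) , (layer (suc zero) M , pm₂)
    where
    open ≤-Reasoning
    X = fromList (endpoints (layer zero M))
    |M|≡n : length M ≡ n
    |M|≡n = ≤-antisym (length-matching≤n m) (≮⇒≥ λ |M|<n →
              <⇒≱ (length<⇒weight< {M = M} |M|<n) (≤-trans (m≤m+n (n * n) k) heavy))
    pm₁ = layer-isPerfectMatching m (length-matching≡n⇒covers m |M|≡n) zero
    pm₂ = layer-isPerfectMatching m (length-matching≡n⇒covers m |M|≡n) (suc zero)
    k≤excess : k ≤ excess M
    k≤excess = +-cancelˡ-≤ (n * n) k (excess M) (begin
      n * n + k                ≤⟨ heavy ⟩
      weight n M               ≡⟨ weight≡ M ⟩
      n * length M + excess M  ≡⟨ cong (λ l → n * l + excess M) |M|≡n ⟩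
      n * n + excess M         ∎)
    k≤∣X∣ : k ≤ ∣ X ∣
    k≤∣X∣ = begin
      k                                                    ≤⟨ k≤excess ⟩
      excess M                                             ≤⟨ excess≤length-layers adjs ⟩
      length (layer zero M) + length (layer (suc zero) M)
        ≡⟨ length-perfectMatchings {G₁ = G₁} {G₂} pm₁ pm₂ ⟩
      ∣ X ∣                                                ∎

  module _ {X : Subset n} {M₁ M₂ : List (Fin n × Fin n)}
           (pm₁ : IsPerfectMatchingOf G₁ X M₁) (pm₂ : IsPerfectMatchingOf G₂ X M₂) where

    combined : List (Edge′ n)
    combined = embed zero M₁ ++ embed (suc zero) M₂ ++ rungs (elements (∁ X))

    private
      E₁ E₂ E₃ : List (Vertex′ n)
      E₁ = map (copy zero) (endpoints M₁)
      E₂ = map (copy (suc zero)) (endpoints M₂)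
      E₃ = endpoints (rungs (elements (∁ X)))

      endpoints-combined : endpoints combined ≡ E₁ ++ E₂ ++ E₃
      endpoints-combined = begin
        endpoints combined
          ≡⟨ endpoints-++ (embed zero M₁) _ ⟩
        endpoints (embed zero M₁) ++ endpoints (embed (suc zero) M₂ ++ rungs (elements (∁ X)))
          ≡⟨ cong₂ _++_ (endpoints-map (copy zero) M₁) (endpoints-++ (embed (suc zero) M₂) _) ⟩
        E₁ ++ endpoints (embed (suc zero) M₂) ++ E₃
          ≡⟨ cong (λ vs → E₁ ++ vs ++ E₃) (endpoints-map (copy (suc zero)) M₂) ⟩
        E₁ ++ E₂ ++ E₃ ∎
        where open ≡-Reasoning

      ∈-E₃⇒∉X : ∀ {a} → a ∈ E₃ → proj₁ a ∉ₛ X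
      ∈-E₃⇒∉X a∈E₃ = x∈∁p⇒x∉p (∈-elements⁻ (∈-endpoints-rungs⁻ a∈E₃))

      ∈-copy-endpoints⁻ : ∀ {G i M} → IsPerfectMatchingOf G X M → ∀ {a} → a ∈ map (copy i) (endpoints M) →
               proj₁ a ∈ₛ X × proj₂ a ≡ i
      ∈-copy-endpoints⁻ {G} pm a∈ with ∈-map⁻ _ a∈
      ... | _ , x∈M , refl = perfectMatching-endpoints⊆ {G = G} pm x∈M , refl

      disjoint₂₃ : Disjoint E₂ E₃
      disjoint₂₃ (a∈E₂ , a∈E₃) = ∈-E₃⇒∉X a∈E₃ (proj₁ (∈-copy-endpoints⁻ {G₂} {suc zero} pm₂ a∈E₂))

      disjoint₁₂ : Disjoint E₁ E₂
      disjoint₁₂ (a∈E₁ , a∈E₂) with proj₂ (∈-copy-endpoints⁻ {G₁} {zero} pm₁ a∈E₁) | proj₂ (∈-copy-endpoints⁻ {G₂} {suc zero} pm₂ a∈E₂)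
      ... | refl | ()

      disjoint₁₃ : Disjoint E₁ E₃
      disjoint₁₃ (a∈E₁ , a∈E₃) = ∈-E₃⇒∉X a∈E₃ (proj₁ (∈-copy-endpoints⁻ {G₁} {zero} pm₁ a∈E₁))

      disjoint₁₂₃ : Disjoint E₁ (E₂ ++ E₃)
      disjoint₁₂₃ (a∈E₁ , a∈E₂₃) =
        Sum.[ (λ a∈E₂ → disjoint₁₂ (a∈E₁ , a∈E₂)) , (λ a∈E₃ → disjoint₁₃ (a∈E₁ , a∈E₃)) ]
          (∈-++⁻ E₂ a∈E₂₃)

    combined-isMatching : IsMatching Adj′ combined
    combined-isMatching =
      All-++⁺ (embed-adjacent zero M₁ (proj₁ (proj₁ pm₁)))
        (All-++⁺ (embed-adjacent (suc zero) M₂ (proj₁ (proj₁ pm₂))) (rungs-adjacent (elements (∁ X)))) ,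
      subst Unique (sym endpoints-combined)
        (Unique.++⁺ (Unique.map⁺ (cong proj₁) (proj₂ (proj₁ pm₁)))
                    (Unique.++⁺ (Unique.map⁺ (cong proj₁) (proj₂ (proj₁ pm₂)))
                                (rungs-Unique _ (elements-Unique (∁ X))) disjoint₂₃)
                    disjoint₁₂₃)

    length-combined : length combined ≡ n
    length-combined = begin
      length combined
        ≡⟨ length-++ (embed zero M₁) ⟩
      length (embed zero M₁) + length (embed (suc zero) M₂ ++ rungs (elements (∁ X)))
        ≡⟨ cong (length (embed zero M₁) +_) (length-++ (embed (suc zero) M₂)) ⟩
      length (embed zero M₁) + (length (embed (suc zero) M₂) + length (rungs (elements (∁ X))))
        ≡⟨ cong₂ _+_ (length-map _ M₁) (cong₂ _+_ (length-map _ M₂) (length-map _ (elements (∁ X)))) ⟩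
      length M₁ + (length M₂ + length (elements (∁ X)))
        ≡⟨ cong (λ l → length M₁ + (length M₂ + l)) (trans (length-elements (∁ X)) (∣∁p∣≡n∸∣p∣ X)) ⟩
      length M₁ + (length M₂ + (n ∸ ∣ X ∣))
        ≡⟨ +-assoc (length M₁) (length M₂) _ ⟨
      length M₁ + length M₂ + (n ∸ ∣ X ∣)
        ≡⟨ cong (_+ (n ∸ ∣ X ∣)) (length-perfectMatchings {G₁ = G₁} {G₂} pm₁ pm₂) ⟩
      ∣ X ∣ + (n ∸ ∣ X ∣)
        ≡⟨ m+[n∸m]≡n (∣p∣≤n X) ⟩
      n ∎
      where open ≡-Reasoning

    excess-combined : excess combined ≡ ∣ X ∣
    excess-combined = begin
      excess combined
        ≡⟨ excess-++ (embed zero M₁) _ ⟩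
      excess (embed zero M₁) + excess (embed (suc zero) M₂ ++ rungs (elements (∁ X)))
        ≡⟨ cong (excess (embed zero M₁) +_) (excess-++ (embed (suc zero) M₂) _) ⟩
      excess (embed zero M₁) + (excess (embed (suc zero) M₂) + excess (rungs (elements (∁ X))))
        ≡⟨ cong₂ _+_ (excess-embed G₁ zero M₁ (proj₁ (proj₁ pm₁)))
             (cong₂ _+_ (excess-embed G₂ (suc zero) M₂ (proj₁ (proj₁ pm₂))) (excess-rungs (elements (∁ X)))) ⟩
      length M₁ + (length M₂ + 0)
        ≡⟨ cong (length M₁ +_) (+-identityʳ (length M₂)) ⟩
      length M₁ + length M₂
        ≡⟨ length-perfectMatchings {G₁ = G₁} {G₂} pm₁ pm₂ ⟩
      ∣ X ∣ ∎
      where open ≡-Reasoning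

    weight-combined : weight n combined ≡ n * n + ∣ X ∣
    weight-combined =
      trans (weight≡ combined) (cong₂ (λ l x → n * l + x) length-combined excess-combined)

  perfectMatchings⇒heavy-matching : ∀ {k} →
    ∃[ X ] (k ≤ ∣ X ∣ × HasPerfectMatching G₁ X × HasPerfectMatching G₂ X) →
    ∃[ M ] (IsMatching Adj′ M × n * n + k ≤ weight n M)
  perfectMatchings⇒heavy-matching (X , k≤∣X∣ , (_ , pm₁) , (_ , pm₂)) =
    combined pm₁ pm₂ , combined-isMatching pm₁ pm₂ ,
    subst (_ ≤_) (sym (weight-combined pm₁ pm₂)) (+-monoʳ-≤ (n * n) k≤∣X∣)

lemma11 : (n : ℕ) (G₁ G₂ : Graph n) (k : ℕ) →
    (∃[ X ] (k ≤ ∣ X ∣ × HasPerfectMatching G₁ X × HasPerfectMatching G₂ X))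
    ⇔ (∃[ M ] (IsMatching (AdjG' G₁ G₂) M × n * n + k ≤ weight n M))
lemma11 n G₁ G₂ k = mk⇔ (perfectMatchings⇒heavy-matching G₁ G₂) (heavy-matching⇒perfectMatchings G₁ G₂)
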